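{- Let $R:X\leftrightarrow\mathcal{P}Y$ be a multirelation. Then (1) ${\in_X}\ast\uparrow R=\uparrow R$; (2) if $R$ is inner total, then $\uparrow R=R\ast{\in_Y}$.
   Context: A multirelation is a relation $R\subseteq X\times\mathcal{P}Y$. ${\in_X}=\{(a,A)\mid a\in A\subseteq X\}:X\leftrightarrow\mathcal{P}X$ is the membership relation. Up-closure: $\uparrow R=\{(a,A)\mid\exists B.\,(a,B)\in R\wedge B\subseteq A\subseteq Y\}$. Peleg composition: for $R:X\leftrightarrow\mathcal{P}Y$, $S:Y\leftrightarrow\mathcal{P}Z$, $R\ast S=\{(a,C)\mid\exists B.\,(a,B)\in R\wedge\exists f:Y\to\mathcal{P}Z.\,(\forall b\in B.\,(b,f(b))\in S)\wedge C=\bigcup_{b\in B}f(b)\}$. $R$ is inner total if every $B$ with $(a,B)\in R$ is non-empty. -}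

module Defs where

open import Level using (Level; 0ℓ; Lift) renaming (suc to lsuc)
open import Data.Product using (Σ; ∃; _×_; _,_)
open import Relation.Unary using (Pred; _⊆_; _≐_; Satisfiable)

𝒫 : Set → Set₁
𝒫 X = Pred X 0ℓ

MRel : Set → Set → Set₂
MRel X Y = X → 𝒫 Y → Set₁

∈ᴹ : (X : Set) → MRel X X
∈ᴹ X a A = Lift (lsuc 0ℓ) (A a)

↑ : {X Y : Set} → MRel X Y → MRel X Y
↑ R a A = Σ (𝒫 _) λ B → R a B × (B ⊆ A)

⋃[_]_ : {Y Z : Set} → 𝒫 Y → (Y → 𝒫 Z) → 𝒫 Z
⋃[ B ] f = λ z → ∃ λ b → B b × f b z

_∗_ : {X Y Z : Set} → MRel X Y → MRel Y Z → MRel X Z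
(R ∗ S) a C = Σ (𝒫 _) λ B → R a B ×
  Σ (_ → 𝒫 _) λ f → (∀ b → B b → S b (f b)) × (C ≐ ⋃[ B ] f)

InnerTotal : {X Y : Set} → MRel X Y → Set₁
InnerTotal R = ∀ a B → R a B → Satisfiable B

_≡ᴹ_ : {X Y : Set} → MRel X Y → MRel X Y → Set₁
R ≡ᴹ S = ∀ a A → (R a A → S a A) × (S a A → R a A)

{-# OPTIONS --safe #-}
module Submission where

open import Defs
open import Data.Product using (_×_; _,_)
open import Function using (const)
open import Level using (lift; lower)
open import Relation.Binary.PropositionalEquality using (_≡_; refl)
open import Relation.Unary using (_⊆_; _≐_; Satisfiable; ｛_｝)

-- The Peleg composites in the theorem are all realised by a constant
-- choice function over a suitable set of intermediate points: the singleton
-- {a} for ∈ ∗ ↑R, and an inhabited witness B of R for R ∗ ∈.  Conversely,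
-- choices made from ∈ can only enlarge the set they start from, and those
-- made from an up-closed S land in S.

_⊆ᴹ_ : {X Y : Set} → MRel X Y → MRel X Y → Set₁
R ⊆ᴹ S = ∀ a A → R a A → S a A

⊆ᴹ-antisym : {X Y : Set} {R S : MRel X Y} → R ⊆ᴹ S → S ⊆ᴹ R → R ≡ᴹ S
⊆ᴹ-antisym R⊆S S⊆R a A = R⊆S a A , S⊆R a A

UpClosed : {X Y : Set} → MRel X Y → Set₁
UpClosed S = ∀ {a B C} → S a B → B ⊆ C → S a C

↑-upClosed : {X Y : Set} (R : MRel X Y) → UpClosed (↑ R)
↑-upClosed R (D , RaD , D⊆B) B⊆C = D , RaD , λ d → B⊆C (D⊆B d)

⋃-const : {Y Z : Set} {B : 𝒫 Y} (C : 𝒫 Z) → Satisfiable B → C ≐ ⋃[ B ] const C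
⋃-const C (b , Bb) = (λ c → b , Bb , c) , λ { (_ , _ , c) → c }

⋃-⊇ : {Y : Set} {B : 𝒫 Y} (f : Y → 𝒫 Y) → (∀ b → B b → f b b) → B ⊆ ⋃[ B ] f
⋃-⊇ f b∈fb {b} Bb = b , Bb , b∈fb b Bb

∈ᴹ-∗-⊆ : {X Y : Set} (S : MRel X Y) → UpClosed S → (∈ᴹ X ∗ S) ⊆ᴹ S
∈ᴹ-∗-⊆ S up a C (B , lift Ba , f , Sf , f⊆C , C⊆f) =
  up (Sf a Ba) λ c → C⊆f (a , Ba , c)

⊆-∈ᴹ-∗ : {X Y : Set} (S : MRel X Y) → S ⊆ᴹ (∈ᴹ X ∗ S)
⊆-∈ᴹ-∗ S a C SaC = ｛ a ｝ , lift refl , const C , S-on-｛a｝ , ⋃-const C (a , refl)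
  where
  S-on-｛a｝ : ∀ b → a ≡ b → S b C
  S-on-｛a｝ b refl = SaC

∗-∈ᴹ-⊆-↑ : {X Y : Set} (R : MRel X Y) → (R ∗ ∈ᴹ Y) ⊆ᴹ ↑ R
∗-∈ᴹ-⊆-↑ R a A (B , RaB , f , f∋ , f⊆A , A⊆f) =
  B , RaB , λ Bb → A⊆f (⋃-⊇ f (λ b Bb → lower (f∋ b Bb)) Bb)

↑-⊆-∗-∈ᴹ : {X Y : Set} (R : MRel X Y) → InnerTotal R → ↑ R ⊆ᴹ (R ∗ ∈ᴹ Y)
↑-⊆-∗-∈ᴹ R innerTotal a A (D , RaD , D⊆A) =
  D , RaD , const A , (λ _ d → lift (D⊆A d)) , ⋃-const A (innerTotal a D RaD)

lemma4p7 : {X Y : Set} (R : MRel X Y) →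
    ((∈ᴹ X ∗ ↑ R) ≡ᴹ ↑ R) × (InnerTotal R → ↑ R ≡ᴹ (R ∗ ∈ᴹ Y))
lemma4p7 R =
  ⊆ᴹ-antisym (∈ᴹ-∗-⊆ (↑ R) (↑-upClosed R)) (⊆-∈ᴹ-∗ (↑ R)) ,
  λ innerTotal → ⊆ᴹ-antisym (↑-⊆-∗-∈ᴹ R innerTotal) (∗-∈ᴹ-⊆-↑ R)
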